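{- Let $G$ be a comparability graph, let $T$ be the canonical modular decomposition of $G$, and let $W$ be a partial orientation of $G$ that gives a partial orientation $P$ of the quotient graphs of $T$. Then $W$ extends to a transitive orientation of $G$ if and only if $P$ extends to a transitive orientation of the quotient graphs of $T$.
   Context: For a rooted tree $T$ and node $\mu$, $L(\mu)$ is the leaf set of the subtree rooted at $\mu$. A module of $G=(V,E)$ is a nonempty $M\subseteq V$ such that each vertex outside $M$ is adjacent to all or none of $M$; $G$ with $\ge 3$ vertices is prime if its only modules are $V$ and singletons. A modular decomposition of $G$ is a rooted tree with leaf set $V$ such that every $L(\mu)$ is a module. The quotient graph $G[\mu]$ of an inner node $\mu$ is obtained from $G[L(\mu)]$ by contracting $L(\nu)$ to one vertex for each child $\nu$ (its vertices are identified with the children of $\mu$). The canonical modular decomposition is the unique modular decomposition whose quotient graphs are all edgeless, complete or prime and in which no two adjacent nodes both have complete or both have edgeless quotient graphs. Every edge $uv$ of $G$ is represented by the edge $\nu\lambda$ of $G[\mu]$, where $\mu$ is the lowest common ancestor of $u,v$ in $T$ and $\nu,\lambda$ are the children of $\mu$ with $u\in L(\nu)$, $v\in L(\lambda)$. An orientation is transitive if $uv,vw$ in it imply $uw$ in it; a comparability graph admits a transitive orientation. A partial orientation $W$ of $G$ is an orientation of a subset of its edges. $W$ gives the partial orientation $P$ of the quotient graphs of $T$ in which exactly the quotient edges representing at least one edge of $W$ are oriented, a quotient edge $\nu\lambda$ being oriented from $\nu$ to $\lambda$ when the edges of $W$ it represents are oriented from $L(\nu)$ to $L(\lambda)$; $P$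 exists only if all edges of $W$ represented by the same quotient edge are oriented in the same direction between the two leaf sets. A transitive orientation of the quotient graphs of $T$ is a choice of a transitive orientation of every quotient graph; it extends $P$ if it contains $P$. -}

module Defs where

open import Data.Nat using (ℕ)
open import Data.Fin using (Fin)
open import Data.Maybe using (Maybe; just; nothing)
open import Data.Product using (Σ; ∃; ∃-syntax; _×_; _,_; proj₁)
open import Data.Sum using (_⊎_)
open import Data.Empty using (⊥)
open import Relation.Nullary using (¬_)
open import Relation.Binary.PropositionalEquality using (_≡_; _≢_)
open import Function.Bundles using (_⇔_)

module _ {V : Set} (E : V → V → Set) where

  IsModule : (V → Set) → Set
  IsModule M = (Σ V M)
             × (∀ x → ¬ M x → (∀ y → M y → E x y) ⊎ (∀ y → M y → ¬ E x y))

  AtLeast3 : Set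
  AtLeast3 = Σ V λ x → Σ V λ y → Σ V λ z → (x ≢ y × x ≢ z × y ≢ z)

  IsPrime : Set₁
  IsPrime = AtLeast3
          × (∀ (M : V → Set) → IsModule M →
               (∀ x → M x) ⊎ (∃[ x ] (∀ y → M y ⇔ (y ≡ x))))

  IsEdgeless : Set
  IsEdgeless = ∀ x y → ¬ E x y

  IsComplete : Set
  IsComplete = ∀ x y → x ≢ y → E x y

  IsPartialOrientation : (V → V → Set) → Set
  IsPartialOrientation O = (∀ x y → O x y → E x y)
                         × (∀ x y → O x y → ¬ O y x)

  IsOrientation : (V → V → Set) → Set
  IsOrientation O = IsPartialOrientation O
                  × (∀ x y → E x y → O x y ⊎ O y x)

  IsTransitive : (V → V → Set) → Set
  IsTransitive O = ∀ x y z → O x y → O y z → O x z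

  IsTransitiveOrientation : (V → V → Set) → Set
  IsTransitiveOrientation O = IsOrientation O × IsTransitive O

  IsComparabilityGraph : Set₁
  IsComparabilityGraph = Σ (V → V → Set) IsTransitiveOrientation

record Graph (n : ℕ) : Set₁ where
  field
    E      : Fin n → Fin n → Set
    sym    : ∀ u v → E u v → E v u
    irrefl : ∀ u → ¬ E u u

data AncOf {m : ℕ} (parent : Fin m → Maybe (Fin m)) (a : Fin m) : Fin m → Set where
  here  : AncOf parent a a
  there : ∀ {d p} → parent d ≡ just p → AncOf parent a p → AncOf parent a d

record RootedTree (n : ℕ) : Set where
  field
    m      : ℕ
    parent : Fin m → Maybe (Fin m)
    root   : Fin m
    root-parent : parent root ≡ nothing
    root-unique : ∀ x → parent x ≡ nothing → x ≡ root
    reach-root  : ∀ x → AncOf parent root x   -- no cycles: every node reaches the root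
    leaf        : Fin n → Fin m
    leaf-inj    : ∀ u v → leaf u ≡ leaf v → u ≡ v
    leaf-isLeaf : ∀ v → ∀ y → ¬ (parent y ≡ just (leaf v))
    leaf-onto   : ∀ x → (∀ y → ¬ (parent y ≡ just x)) → ∃[ v ] leaf v ≡ x

  Anc : Fin m → Fin m → Set
  Anc = AncOf parent

  Child : Fin m → Fin m → Set
  Child ν μ = parent ν ≡ just μ

  IsLeaf : Fin m → Set
  IsLeaf x = ∀ y → ¬ Child y x

  L : Fin m → Fin n → Set
  L μ v = Anc μ (leaf v)

  -- vertices of the quotient graph G[μ] are the children of μ
  QV : Fin m → Set
  QV μ = Σ (Fin m) (λ ν → Child ν μ)


module _ {n : ℕ} (G : Graph n) (T : RootedTree n) where
  open Graph G
  open RootedTree T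

  QE : (μ : Fin m) → QV μ → QV μ → Set
  QE μ (ν , _) (λ' , _) = ν ≢ λ' × ∃[ u ] ∃[ v ] (L ν u × L λ' v × E u v)

  IsModularDecomposition : Set
  IsModularDecomposition = ∀ μ → IsModule E (L μ)

  Inner : Fin m → Set
  Inner μ = ¬ IsLeaf μ

  AtLeast2Children : Fin m → Set
  AtLeast2Children μ = ∃[ ν ] ∃[ λ' ] (Child ν μ × Child λ' μ × ν ≢ λ')

  IsCanonicalModularDecomposition : Set₁
  IsCanonicalModularDecomposition =
      IsModularDecomposition
    × (∀ μ → Inner μ → AtLeast2Children μ)
    × (∀ μ → Inner μ → IsEdgeless (QE μ) ⊎ IsComplete (QE μ) ⊎ IsPrime (QE μ))
    × (∀ μ ν → Inner μ → Inner ν → Child ν μ →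
          ¬ (IsComplete (QE μ) × IsComplete (QE ν))
        × ¬ (IsEdgeless (QE μ) × IsEdgeless (QE ν)))

  -- the (candidate) partial orientation P of the quotient graphs induced
  -- by W: the quotient edge νλ of G[μ] is oriented ν → λ iff some edge
  -- of W represented by it is oriented from L(ν) to L(λ)
  InducedP : (Fin n → Fin n → Set) → (μ : Fin m) → QV μ → QV μ → Set
  InducedP W μ (ν , _) (λ' , _) = ν ≢ λ' × ∃[ u ] ∃[ v ] (L ν u × L λ' v × W u v)

  GivesPartialOrientation : (Fin n → Fin n → Set) → Set
  GivesPartialOrientation W =
    ∀ μ x y → InducedP W μ x y → ¬ InducedP W μ y x

  ExtendsToTransitiveOrientation : (Fin n → Fin n → Set) → Set₁
  ExtendsToTransitiveOrientation W =
    Σ (Fin n → Fin n → Set) (λ O → IsTransitiveOrientation E O × (∀ u v → W u v → O u v))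

  QuotientExtends : (Fin n → Fin n → Set) → Set₁
  QuotientExtends W =
    Σ ((μ : Fin m) → QV μ → QV μ → Set) λ O → ((∀ μ → Inner μ → IsTransitiveOrientation (QE μ) (O μ))
           × (∀ μ x y → InducedP W μ x y → O μ x y))

{-# OPTIONS --safe #-}
-- If every quotient graph G[μ] carries a transitive orientation, orient each edge uv of G as its
-- representative νλ at the lowest common ancestor μ of u and v.  Two edges uv, vw are represented
-- either at the same node, where transitivity of G[μ] applies, or the lower node lies inside one
-- child of the upper one, and then uw is represented like the edge at the upper node.
--
-- Conversely, a transitive orientation O of G induces P on the quotients, and the content is that O
-- orients all edges between the leaf sets of two sibling children x, y of μ alike.  Otherwise
-- totality produces a → b → a′ with a, a′ ∈ L(x), b ∈ L(y).  This is impossible when G[μ] is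
-- edgeless; when G[μ] is complete, L(x) would be the join of {z | z → b} and {z | b → z}, which
-- cannot happen since x is a leaf or G[x] is not complete; when G[μ] is prime, the children that are x or contain
-- some w with a → w → a′ form a module containing x and y, hence all children, making x universal.
module Submission where

open import Defs
open import Data.Nat using (ℕ; zero; suc; _≤_)
open import Data.Nat.Properties using (≤-refl; ≤-trans; n≤1+n; 1+n≰n)
open import Data.Fin using (Fin) renaming (_≟_ to _≟ᶠ_)
open import Data.Fin.Properties using (all?)
open import Data.Maybe using (just)
open import Data.Maybe.Properties using (just-injective) renaming (≡-dec to ≡-decᵐ)
open import Data.Product using (Σ; ∃; ∃-syntax; _×_; _,_; proj₁; proj₂)
open import Data.Sum using (_⊎_; inj₁; inj₂; swap) renaming (map to map⊎)
open import Data.Empty using (⊥)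
open import Relation.Nullary using (¬_; Dec; yes; no; contradiction)
open import Relation.Nullary.Decidable using (¬?)
open import Relation.Binary.Definitions using (DecidableEquality)
open import Relation.Binary.PropositionalEquality
open import Axiom.UniquenessOfIdentityProofs using (module Decidable⇒UIP)
open import Function using (_∘_)
open import Function.Bundles using (_⇔_; mk⇔; module Equivalence)

module TransitiveOrientation {V : Set} {E O : V → V → Set} (hO : IsTransitiveOrientation E O) where

  O⇒E : ∀ {x y} → O x y → E x y
  O⇒E = proj₁ (proj₁ (proj₁ hO)) _ _

  O-asym : ∀ {x y} → O x y → ¬ O y x
  O-asym = proj₂ (proj₁ (proj₁ hO)) _ _

  O-total : ∀ {x y} → E x y → O x y ⊎ O y x
  O-total = proj₂ (proj₁ hO) _ _

  O-trans : ∀ {x y z} → O x y → O y z → O x z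
  O-trans = proj₂ hO _ _ _

two-values⇒¬AtLeast3 : ∀ {V : Set} {E : V → V → Set} {x y : V} → (∀ v → v ≡ x ⊎ v ≡ y) → ¬ AtLeast3 E
two-values⇒¬AtLeast3 class (p , q , r , p≢q , p≢r , q≢r) with class p | class q | class r
... | inj₁ p≡x | inj₁ q≡x | _        = p≢q (trans p≡x (sym q≡x))
... | inj₂ p≡y | inj₂ q≡y | _        = p≢q (trans p≡y (sym q≡y))
... | inj₁ p≡x | _        | inj₁ r≡x = p≢r (trans p≡x (sym r≡x))
... | inj₂ p≡y | _        | inj₂ r≡y = p≢r (trans p≡y (sym r≡y))
... | _        | inj₁ q≡x | inj₁ r≡x = q≢r (trans q≡x (sym r≡x))
... | _        | inj₂ q≡y | inj₂ r≡y = q≢r (trans q≡y (sym r≡y))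

module Prime {V : Set} {E : V → V → Set} (prime : IsPrime E) where
  open Equivalence

  module-∋₂⇒whole : ∀ {M x y} → IsModule E M → M x → M y → x ≢ y → ∀ z → M z
  module-∋₂⇒whole {M} {x} {y} mod Mx My x≢y with proj₂ prime M mod
  ... | inj₁ whole     = whole
  ... | inj₂ (z , M≡z) = contradiction (trans (to (M≡z x) Mx) (sym (to (M≡z y) My))) x≢y

  ¬universal : DecidableEquality V → ∀ c → ¬ (∀ κ → κ ≢ c → E c κ)
  ¬universal _≟_ c universal with proj₂ prime (_≢ c) (others , universal-outside)
    where
      others : Σ V (_≢ c)
      others with proj₁ prime
      ... | p , q , _ , p≢q , _ with p ≟ c
      ...   | no p≢c   = p , p≢c
      ...   | yes refl = q , p≢q ∘ sym

      universal-outside : ∀ x → ¬ x ≢ c → (∀ y → y ≢ c → E x y) ⊎ (∀ y → y ≢ c → ¬ E x y)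
      universal-outside x x≡c with x ≟ c
      ... | yes refl = inj₁ universal
      ... | no x≢c   = contradiction x≢c x≡c
  ... | inj₁ whole     = whole c refl
  ... | inj₂ (z , M≡z) = two-values⇒¬AtLeast3 {E = E} c-or-z (proj₁ prime)
    where
      c-or-z : ∀ v → v ≡ c ⊎ v ≡ z
      c-or-z v with v ≟ c
      ... | yes v≡c = inj₁ v≡c
      ... | no v≢c  = inj₂ (to (M≡z v) v≢c)

  ¬joined-module-cover : DecidableEquality V → (∀ {x y} → E x y → E y x)
    → ∀ {A B} → IsModule E A → IsModule E B
    → (∀ x → A x ⊎ B x) → (∀ {x y} → A x → B y → x ≢ y → E x y) → ⊥
  ¬joined-module-cover _≟_ E-sym {A} {B} modA modB cover join
    with proj₂ prime A modA | proj₂ prime B modB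
  ... | inj₁ wholeA | inj₁ wholeB =
    ¬universal _≟_ c λ κ κ≢c → join (wholeA c) (wholeB κ) (κ≢c ∘ sym)
    where c = proj₁ (proj₁ prime)
  ... | inj₁ wholeA | inj₂ (y , B≡y) =
    ¬universal _≟_ y λ κ κ≢y → E-sym (join (wholeA κ) (from (B≡y y) refl) κ≢y)
  ... | inj₂ (x , A≡x) | inj₁ wholeB =
    ¬universal _≟_ x λ κ κ≢x → join (from (A≡x x) refl) (wholeB κ) (κ≢x ∘ sym)
  ... | inj₂ (x , A≡x) | inj₂ (y , B≡y) =
    two-values⇒¬AtLeast3 {E = E} (λ v → map⊎ (to (A≡x v)) (to (B≡y v)) (cover v)) (proj₁ prime)

module DecompositionTree {n : ℕ} (T : RootedTree n) where
  open RootedTree T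

  anc-trans : ∀ {a b c} → Anc a b → Anc b c → Anc a c
  anc-trans p here        = p
  anc-trans p (there e q) = there e (anc-trans p q)

  child⇒anc : ∀ {c a} → Child c a → Anc a c
  child⇒anc e = there e here

  root-orphan : ∀ {p} → ¬ Child root p
  root-orphan e with trans (sym root-parent) e
  ... | ()

  distance : ∀ {a d} → Anc a d → ℕ
  distance here        = zero
  distance (there _ p) = suc (distance p)

  root-distance-unique : ∀ {x} (r s : Anc root x) → distance r ≡ distance s
  root-distance-unique here        here         = refl
  root-distance-unique here        (there e _)  = contradiction e root-orphan
  root-distance-unique (there e _) here         = contradiction e root-orphan
  root-distance-unique (there e r) (there e′ s) with just-injective (trans (sym e) e′)
  ... | refl = cong suc (root-distance-unique r s)

  depth : Fin m → ℕ
  depth x = distance (reach-root x)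

  depth-child : ∀ {c a} → Child c a → depth c ≡ suc (depth a)
  depth-child {c} {a} = go (reach-root c)
    where
      go : ∀ {c} (r : Anc root c) → Child c a → distance r ≡ suc (depth a)
      go here         e = contradiction e root-orphan
      go (there e′ r) e with just-injective (trans (sym e′) e)
      ... | refl = cong suc (root-distance-unique r (reach-root a))

  depth-anc : ∀ {a d} → Anc a d → depth a ≤ depth d
  depth-anc here = ≤-refl
  depth-anc (there e p) rewrite depth-child e = ≤-trans (depth-anc p) (n≤1+n _)

  child-¬anc : ∀ {c a} → Child c a → ¬ Anc c a
  child-¬anc e p = 1+n≰n (subst (_≤ depth _) (depth-child e) (depth-anc p))

  anc-cmp : ∀ {a b d} → Anc a d → Anc b d → Anc a b ⊎ Anc b a
  anc-cmp here        q            = inj₂ q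
  anc-cmp (there e p) here         = inj₁ (there e p)
  anc-cmp (there e p) (there e′ q) with just-injective (trans (sym e) e′)
  ... | refl = anc-cmp p q

  sibling-anc⇒≡ : ∀ {ν λ′ μ} → Child ν μ → Child λ′ μ → Anc ν λ′ → ν ≡ λ′
  sibling-anc⇒≡ cν cλ here = refl
  sibling-anc⇒≡ cν cλ (there e p) with just-injective (trans (sym e) cλ)
  ... | refl = contradiction p (child-¬anc cν)

  -- Anc is built bottom-up; Desc is the same relation built top-down, so that descending the tree
  -- is structural recursion.
  data Desc : Fin m → Fin m → Set where
    stop : ∀ {a} → Desc a a
    step : ∀ {c a d} → Child c a → Desc c d → Desc a d

  desc-snoc : ∀ {a p d} → Desc a p → Child d p → Desc a d
  desc-snoc stop       e = step e stop
  desc-snoc (step c r) e = step c (desc-snoc r e)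

  anc⇒desc : ∀ {a d} → Anc a d → Desc a d
  anc⇒desc here        = stop
  anc⇒desc (there e p) = desc-snoc (anc⇒desc p) e

  desc⇒anc : ∀ {a d} → Desc a d → Anc a d
  desc⇒anc stop       = here
  desc⇒anc (step c r) = anc-trans (child⇒anc c) (desc⇒anc r)

  descend : ∀ {a d} → Anc a d → a ≡ d ⊎ ∃[ c ] Child c a × Anc c d
  descend p with anc⇒desc p
  ... | stop     = inj₁ refl
  ... | step c r = inj₂ (_ , c , desc⇒anc r)

  leaf-desc : ∀ {u d} → Desc (leaf u) d → leaf u ≡ d
  leaf-desc stop       = refl
  leaf-desc (step c _) = contradiction c (leaf-isLeaf _ _)

  L-leaf : ∀ {u v} → L (leaf u) v → u ≡ v
  L-leaf p = leaf-inj _ _ (leaf-desc (anc⇒desc p))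

  isLeaf? : ∀ ν → Dec (IsLeaf ν)
  isLeaf? ν = all? λ y → ¬? (≡-decᵐ _≟ᶠ_ (parent y) (just ν))

  QV-≡ : ∀ {μ} {x y : QV μ} → proj₁ x ≡ proj₁ y → x ≡ y
  QV-≡ {x = ν , c} {.ν , c′} refl = cong (ν ,_) (Decidable⇒UIP.≡-irrelevant (≡-decᵐ _≟ᶠ_) c c′)

  _≟QV_ : ∀ {μ} → DecidableEquality (QV μ)
  x ≟QV y with proj₁ x ≟ᶠ proj₁ y
  ... | yes x≡y = yes (QV-≡ x≡y)
  ... | no x≢y  = no (x≢y ∘ cong proj₁)

  QV-inner : ∀ {μ} → QV μ → ¬ IsLeaf μ
  QV-inner (ν , c) μ-leaf = μ-leaf ν c

  LQ : ∀ {μ} → QV μ → Fin n → Set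
  LQ x = L (proj₁ x)

  LQ⊆L : ∀ {μ u} (x : QV μ) → LQ x u → L μ u
  LQ⊆L x = anc-trans (child⇒anc (proj₂ x))

  sibling-≡ : ∀ {μ u} (x y : QV μ) → LQ x u → LQ y u → x ≡ y
  sibling-≡ x y xu yu with anc-cmp xu yu
  ... | inj₁ x≤y = QV-≡ (sibling-anc⇒≡ (proj₂ x) (proj₂ y) x≤y)
  ... | inj₂ y≤x = QV-≡ (sym (sibling-anc⇒≡ (proj₂ y) (proj₂ x) y≤x))

  siblings-disjoint : ∀ {μ u} (x y : QV μ) → proj₁ x ≢ proj₁ y → LQ x u → ¬ LQ y u
  siblings-disjoint x y x≢y xu yu = x≢y (cong proj₁ (sibling-≡ x y xu yu))

  inner-child : ∀ {ν u} → ¬ IsLeaf ν → L ν u → Σ (QV ν) λ c → LQ c u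
  inner-child ν-inner νu with descend νu
  ... | inj₁ refl               = contradiction (leaf-isLeaf _) ν-inner
  ... | inj₂ (c , c-child , cu) = (c , c-child) , cu

  other-child : ∀ {μ} → (∃[ ν ] ∃[ λ′ ] (Child ν μ × Child λ′ μ × ν ≢ λ′))
              → (c : QV μ) → Σ (QV μ) λ t → proj₁ t ≢ proj₁ c
  other-child (ν , λ′ , cν , cλ , ν≢λ) c with ν ≟ᶠ proj₁ c
  ... | yes refl = (λ′ , cλ) , ν≢λ ∘ sym
  ... | no ν≢c   = (ν , cν) , ν≢c

  Splits : Fin m → Fin n → Fin n → Set
  Splits μ u v = Σ (QV μ) λ x → Σ (QV μ) λ y → proj₁ x ≢ proj₁ y × LQ x u × LQ y v

  splits-exists : ∀ {u v} → u ≢ v → ∃[ μ ] Splits μ u v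
  splits-exists {u} {v} u≢v = go (anc⇒desc (reach-root (leaf u))) (anc⇒desc (reach-root (leaf v)))
    where
      go : ∀ {a} → Desc a (leaf u) → Desc a (leaf v) → ∃[ μ ] Splits μ u v
      go stop r = contradiction (leaf-inj _ _ (leaf-desc r)) u≢v
      go r stop = contradiction (leaf-inj _ _ (sym (leaf-desc r))) u≢v
      go (step {c} cc r) (step {c′} cc′ r′) with c ≟ᶠ c′
      ... | yes refl = go r r′
      ... | no c≢c′  = _ , (c , cc) , (c′ , cc′) , c≢c′ , desc⇒anc r , desc⇒anc r′

  descendant-⊆-child : ∀ {μ μ′ v} → Anc μ μ′ → (x : QV μ) → LQ x v → L μ′ v
                     → μ ≡ μ′ ⊎ (∀ {w} → L μ′ w → LQ x w)
  descendant-⊆-child μ≤μ′ x xv μ′v with descend μ≤μ′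
  ... | inj₁ μ≡μ′ = inj₁ μ≡μ′
  ... | inj₂ (c , c-child , c≤μ′) with sibling-≡ (c , c-child) x (anc-trans c≤μ′ μ′v) xv
  ...   | refl = inj₂ (anc-trans c≤μ′)

  splits-below : ∀ {μ μ′ u v} → Splits μ u v → Anc μ μ′ → L μ′ u → L μ′ v → μ ≡ μ′
  splits-below (x , y , x≢y , xu , yv) μ≤μ′ μ′u μ′v with descendant-⊆-child μ≤μ′ x xu μ′u
  ... | inj₁ μ≡μ′  = μ≡μ′
  ... | inj₂ μ′⊆x = contradiction yv (siblings-disjoint x y x≢y (μ′⊆x μ′v))

  splits-unique : ∀ {μ μ′ u v} → Splits μ u v → Splits μ′ u v → μ ≡ μ′
  splits-unique s@(x , y , _ , xu , yv) s′@(x′ , y′ , _ , x′u , y′v)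
    with anc-cmp (LQ⊆L x xu) (LQ⊆L x′ x′u)
  ... | inj₁ μ≤μ′ = splits-below s μ≤μ′ (LQ⊆L x′ x′u) (LQ⊆L y′ y′v)
  ... | inj₂ μ′≤μ = sym (splits-below s′ μ′≤μ (LQ⊆L x xu) (LQ⊆L y yv))

module Modules {n : ℕ} (G : Graph n) (T : RootedTree n) (md : IsModularDecomposition G T) where
  open Graph G using (E)
  open RootedTree T
  open DecompositionTree T

  E-sym : ∀ {u v} → E u v → E v u
  E-sym = Graph.sym G _ _

  L-nonempty : ∀ μ → ∃ (L μ)
  L-nonempty μ = proj₁ (md μ)

  all-or-none : ∀ μ {w} → ¬ L μ w → (∀ y → L μ y → E w y) ⊎ (∀ y → L μ y → ¬ E w y)
  all-or-none μ {w} = proj₂ (md μ) w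

  module-adj : ∀ {μ w a a′} → ¬ L μ w → L μ a → L μ a′ → E w a → E w a′
  module-adj {μ} w∉μ μa μa′ wa with all-or-none μ w∉μ
  ... | inj₁ all  = all _ μa′
  ... | inj₂ none = contradiction wa (none _ μa)

  QE-sym : ∀ {μ} {x y : QV μ} → QE G T μ x y → QE G T μ y x
  QE-sym (x≢y , u , v , xu , yv , uv) = x≢y ∘ sym , v , u , yv , xu , E-sym uv

  QE⇒E : ∀ {μ} {x y : QV μ} {u v} → QE G T μ x y → LQ x u → LQ y v → E u v
  QE⇒E {x = x} {y} (x≢y , u₀ , v₀ , xu₀ , yv₀ , u₀v₀) xu yv =
    E-sym (module-adj (siblings-disjoint y x (x≢y ∘ sym) yv) xu₀ xu
            (E-sym (module-adj (siblings-disjoint x y x≢y xu₀) yv₀ yv u₀v₀)))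

module Lift {n : ℕ} (G : Graph n) (T : RootedTree n) (md : IsModularDecomposition G T) where
  open Graph G using (E; irrefl)
  open RootedTree T
  open DecompositionTree T
  open Modules G T md

  QuotientOrientation : Set₁
  QuotientOrientation = (μ : Fin m) → QV μ → QV μ → Set

  lift : QuotientOrientation → Fin n → Fin n → Set
  lift O u v = ∃[ μ ] Σ (QV μ) λ x → Σ (QV μ) λ y → LQ x u × LQ y v × O μ x y

  edge⇒≢ : ∀ {u v} → E u v → u ≢ v
  edge⇒≢ {u} uv refl = irrefl u uv

  lift-extends : ∀ {O W} → (∀ u v → W u v → E u v) → (∀ μ x y → InducedP G T W μ x y → O μ x y)
               → ∀ u v → W u v → lift O u v
  lift-extends W⊆E P⊆O u v uv with splits-exists (edge⇒≢ (W⊆E u v uv))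
  ... | μ , x , y , x≢y , xu , yv = μ , x , y , xu , yv , P⊆O μ x y (x≢y , u , v , xu , yv , uv)

  module _ {O : QuotientOrientation}
           (hO : ∀ μ → Inner G T μ → IsTransitiveOrientation (QE G T μ) (O μ)) where

    private module Oₓ {μ} (x : QV μ) = TransitiveOrientation (hO μ (QV-inner x))
    open Oₓ

    lift-E : ∀ {u v} → lift O u v → E u v
    lift-E (_ , x , y , xu , yv , o) = QE⇒E {x = x} {y} (O⇒E x o) xu yv

    lift-asym : ∀ {u v} → lift O u v → ¬ lift O v u
    lift-asym (μ , x , y , xu , yv , o) (μ′ , y′ , x′ , y′v , x′u , o′)
      with splits-unique (x , y , proj₁ (O⇒E x o) , xu , yv)
                         (x′ , y′ , proj₁ (O⇒E y′ o′) ∘ sym , x′u , y′v)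
    ... | refl with sibling-≡ x x′ xu x′u | sibling-≡ y y′ yv y′v
    ...   | refl | refl = O-asym x o o′

    lift-total : ∀ {u v} → E u v → lift O u v ⊎ lift O v u
    lift-total {u} {v} uv with splits-exists (edge⇒≢ uv)
    ... | μ , x , y , x≢y , xu , yv with O-total x (x≢y , u , v , xu , yv , uv)
    ...   | inj₁ o = inj₁ (μ , x , y , xu , yv , o)
    ...   | inj₂ o = inj₂ (μ , y , x , yv , xu , o)

    lift-compose : ∀ {μ} {x y y′ z : QV μ} {u v w} → LQ x u → LQ y v → LQ y′ v → LQ z w
                 → O μ x y → O μ y′ z → lift O u w
    lift-compose {x = x} {y} {y′} xu yv y′v zw o o′ with sibling-≡ y y′ yv y′v
    ... | refl = _ , _ , _ , xu , zw , O-trans x o o′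

    lift-trans : ∀ {u v w} → lift O u v → lift O v w → lift O u w
    lift-trans (μ₁ , x₁ , y₁ , x₁u , y₁v , o₁) (μ₂ , x₂ , y₂ , x₂v , y₂w , o₂)
      with anc-cmp (LQ⊆L y₁ y₁v) (LQ⊆L x₂ x₂v)
    ... | inj₁ μ₁≤μ₂ with descendant-⊆-child μ₁≤μ₂ y₁ y₁v (LQ⊆L x₂ x₂v)
    ...   | inj₁ refl    = lift-compose x₁u y₁v x₂v y₂w o₁ o₂
    ...   | inj₂ μ₂⊆y₁ = μ₁ , x₁ , y₁ , x₁u , μ₂⊆y₁ (LQ⊆L y₂ y₂w) , o₁
    lift-trans (μ₁ , x₁ , y₁ , x₁u , y₁v , o₁) (μ₂ , x₂ , y₂ , x₂v , y₂w , o₂)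
        | inj₂ μ₂≤μ₁ with descendant-⊆-child μ₂≤μ₁ x₂ x₂v (LQ⊆L y₁ y₁v)
    ...   | inj₁ refl    = lift-compose x₁u y₁v x₂v y₂w o₁ o₂
    ...   | inj₂ μ₁⊆x₂ = μ₂ , x₂ , y₂ , μ₁⊆x₂ (LQ⊆L x₁ x₁u) , y₂w , o₂

    lift-transitiveOrientation : IsTransitiveOrientation E (lift O)
    lift-transitiveOrientation =
      (((λ _ _ → lift-E) , (λ _ _ → lift-asym)) , (λ _ _ → lift-total)) , (λ _ _ _ → lift-trans)

module Canonical {n : ℕ} (G : Graph n) (T : RootedTree n) (canon : IsCanonicalModularDecomposition G T) where
  open Graph G using (E; irrefl)
  open RootedTree T
  open DecompositionTree T
  open Modules G T (proj₁ canon)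

  classify : ∀ μ → Inner G T μ → IsEdgeless (QE G T μ) ⊎ IsComplete (QE G T μ) ⊎ IsPrime (QE G T μ)
  classify = proj₁ (proj₂ (proj₂ canon))

  complete-child-¬complete : ∀ {μ} (x : QV μ) → Inner G T (proj₁ x)
                           → IsComplete (QE G T μ) → ¬ IsComplete (QE G T (proj₁ x))
  complete-child-¬complete {μ} (ν , c) ν-inner μ-complete ν-complete =
    proj₁ (proj₂ (proj₂ (proj₂ canon)) μ ν (QV-inner (ν , c)) ν-inner c) (μ-complete , ν-complete)

  IsJoin : (M P Q : Fin n → Set) → Set
  IsJoin M P Q = (∀ y → M y → P y ⊎ Q y) × (∀ {p q} → P p → Q q → E p q)
               × (∃[ p ] M p × P p) × (∃[ q ] M q × Q q)

  leaf-¬join : ∀ {ν P Q} → IsLeaf ν → ¬ IsJoin (L ν) P Q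
  leaf-¬join {ν} ν-leaf (_ , join , (p , νp , Pp) , (q , νq , Qq)) with leaf-onto ν ν-leaf
  ... | v , refl with L-leaf νp | L-leaf νq
  ...   | refl | refl = irrefl v (join Pp Qq)

  edgeless-¬join : ∀ {ν P Q} → Inner G T ν → IsEdgeless (QE G T ν) → ¬ IsJoin (L ν) P Q
  edgeless-¬join {ν} ν-inner edgeless (cover , join , (p , νp , Pp) , (q , νq , Qq))
    with inner-child ν-inner νp | inner-child ν-inner νq
  ... | cp , cp-p | cq , cq-q with proj₁ cp ≟ᶠ proj₁ cq
  ...   | no cp≢cq = edgeless cp cq (cp≢cq , p , q , cp-p , cq-q , join Pp Qq)
  ...   | yes cp≡cq with other-child (proj₁ (proj₂ canon) ν ν-inner) cq
  ...     | t , t≢cq with L-nonempty (proj₁ t)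
  ...       | w , tw with cover w (LQ⊆L t tw)
  ...         | inj₁ Pw = edgeless t cq (t≢cq , w , q , tw , cq-q , join Pw Qq)
  ...         | inj₂ Qw = edgeless cp t ((λ e → t≢cq (trans (sym e) cp≡cq)) , p , w , cp-p , tw , join Pp Qw)

  Meets : ∀ {ν} → (Fin n → Set) → QV ν → Set
  Meets R κ = ∃[ y ] LQ κ y × R y

  meets-module : ∀ {ν} {P Q : Fin n → Set} → (∀ y → L ν y → P y ⊎ Q y) → (∀ {p q} → P p → Q q → E p q)
               → Σ (QV ν) (Meets P) → IsModule (QE G T ν) (Meets P)
  meets-module {ν} {P} cover join nonempty = nonempty , λ σ σ∉ → inj₁ (adjacent σ σ∉)
    where
      adjacent : ∀ σ → ¬ Meets P σ → ∀ ρ → Meets P ρ → QE G T ν σ ρ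
      adjacent σ σ∉ ρ (x , ρx , Px) with L-nonempty (proj₁ σ)
      ... | t , σt with cover t (LQ⊆L σ σt)
      ...   | inj₁ Pt = contradiction (t , σt , Pt) σ∉
      ...   | inj₂ Qt = σ≢ρ , t , x , σt , ρx , E-sym (join Px Qt)
        where
          σ≢ρ : proj₁ σ ≢ proj₁ ρ
          σ≢ρ σ≡ρ = σ∉ (x , subst (λ z → L z x) (sym σ≡ρ) ρx , Px)

  prime-¬join : ∀ {ν P Q} → Inner G T ν → IsPrime (QE G T ν) → ¬ IsJoin (L ν) P Q
  prime-¬join {ν} {P} {Q} ν-inner prime (cover , join , (p , νp , Pp) , (q , νq , Qq)) =
    Prime.¬joined-module-cover prime _≟QV_ (λ {x} {y} → QE-sym {x = x} {y})
      (meets-module cover join (meeting νp Pp))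
      (meets-module (λ y νy → swap (cover y νy)) (λ Qq Pp → E-sym (join Pp Qq)) (meeting νq Qq))
      covered joined
    where
      meeting : ∀ {R y} → L ν y → R y → Σ (QV ν) (Meets R)
      meeting {y = y} νy Ry with inner-child ν-inner νy
      ... | c , cy = c , y , cy , Ry

      covered : ∀ κ → Meets P κ ⊎ Meets Q κ
      covered κ with L-nonempty (proj₁ κ)
      ... | t , κt = map⊎ (λ Pt → t , κt , Pt) (λ Qt → t , κt , Qt) (cover t (LQ⊆L κ κt))

      joined : ∀ {κ κ′} → Meets P κ → Meets Q κ′ → κ ≢ κ′ → QE G T ν κ κ′
      joined (x , κx , Px) (y , κ′y , Qy) κ≢κ′ = κ≢κ′ ∘ QV-≡ , x , y , κx , κ′y , join Px Qy

  -- A leaf's quotient graph has no vertices, so it is vacuously complete (and edgeless).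
  ¬join : ∀ ν {P Q} → (Inner G T ν → ¬ IsComplete (QE G T ν)) → ¬ IsJoin (L ν) P Q
  ¬join ν ¬complete with isLeaf? ν
  ... | yes ν-leaf = leaf-¬join ν-leaf
  ... | no ν-inner with classify ν ν-inner
  ...   | inj₁ edgeless         = edgeless-¬join ν-inner edgeless
  ...   | inj₂ (inj₁ complete) = contradiction complete (¬complete ν-inner)
  ...   | inj₂ (inj₂ prime)    = prime-¬join ν-inner prime

module Induced {n : ℕ} (G : Graph n) (T : RootedTree n) (canon : IsCanonicalModularDecomposition G T)
               {O : Fin n → Fin n → Set} (hO : IsTransitiveOrientation (Graph.E G) O) where
  open Graph G using (E)
  open RootedTree T
  open DecompositionTree T
  open Modules G T (proj₁ canon)
  open Canonical G T canon
  open TransitiveOrientation hO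

  Via : Fin n → Fin n → Fin n → Set
  Via a w a′ = O a w × O w a′

  via-adjacent : ∀ {ξ a a′ s w} → ¬ L ξ s → L ξ a → L ξ a′ → E s a → ¬ Via a s a′ → Via a w a′ → E s w
  via-adjacent s∉ξ ξa ξa′ sa ¬via (aw , wa′) with O-total sa
  ... | inj₁ s→a = O⇒E (O-trans s→a aw)
  ... | inj₂ a→s with O-total (module-adj s∉ξ ξa ξa′ sa)
  ...   | inj₁ s→a′ = contradiction (a→s , s→a′) ¬via
  ...   | inj₂ a′→s = E-sym (O⇒E (O-trans wa′ a′→s))

  via-nonadjacent : ∀ {ξ a a′ s w} → ¬ L ξ s → L ξ a → L ξ a′ → ¬ E s a → Via a w a′ → ¬ E s w
  via-nonadjacent s∉ξ ξa ξa′ ¬sa (aw , wa′) sw with O-total sw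
  ... | inj₁ s→w = ¬sa (module-adj s∉ξ ξa′ ξa (O⇒E (O-trans s→w wa′)))
  ... | inj₂ w→s = ¬sa (E-sym (O⇒E (O-trans aw w→s)))

  ¬via-prime : ∀ {μ} → IsPrime (QE G T μ) → (x y : QV μ) → proj₁ x ≢ proj₁ y
             → ∀ {a a′ b} → LQ x a → LQ x a′ → LQ y b → ¬ Via a b a′
  ¬via-prime {μ} prime x y x≢y {a} {a′} {b} xa xa′ yb via =
    Prime.¬universal prime _≟QV_ x λ κ κ≢x → x-adjacent κ≢x (S-whole κ)
    where
      S : QV μ → Set
      S κ = κ ≡ x ⊎ ∃[ w ] LQ κ w × Via a w a′

      x-adjacent : ∀ {κ} → κ ≢ x → S κ → QE G T μ x κ
      x-adjacent κ≢x (inj₁ κ≡x)                = contradiction κ≡x κ≢x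
      x-adjacent κ≢x (inj₂ (w , κw , aw , _)) = κ≢x ∘ QV-≡ ∘ sym , a , w , xa , κw , O⇒E aw

      S-module : IsModule (QE G T μ) S
      S-module = (x , inj₁ refl) , outside
        where
          outside : ∀ σ → ¬ S σ → (∀ ρ → S ρ → QE G T μ σ ρ) ⊎ (∀ ρ → S ρ → ¬ QE G T μ σ ρ)
          outside σ σ∉S =
            by-adjacency-to-a (all-or-none (proj₁ σ) (siblings-disjoint x σ (σ≢ (inj₁ refl) ∘ sym) xa))
            where
              σ≢ : ∀ {ρ} → S ρ → proj₁ σ ≢ proj₁ ρ
              σ≢ Sρ σ≡ρ = σ∉S (subst S (sym (QV-≡ σ≡ρ)) Sρ)

              t : Fin n
              t = proj₁ (L-nonempty (proj₁ σ))

              σt : LQ σ t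
              σt = proj₂ (L-nonempty (proj₁ σ))

              t∉x : ¬ LQ x t
              t∉x = siblings-disjoint σ x (σ≢ (inj₁ refl)) σt

              by-adjacency-to-a : (∀ y → LQ σ y → E a y) ⊎ (∀ y → LQ σ y → ¬ E a y)
                                → (∀ ρ → S ρ → QE G T μ σ ρ) ⊎ (∀ ρ → S ρ → ¬ QE G T μ σ ρ)
              by-adjacency-to-a (inj₁ a-adj) = inj₁ λ where
                ρ Sρ@(inj₁ refl) → σ≢ Sρ , t , a , σt , xa , E-sym (a-adj t σt)
                ρ Sρ@(inj₂ (w , ρw , via-w)) → σ≢ Sρ , t , w , σt , ρw ,
                  via-adjacent t∉x xa xa′ (E-sym (a-adj t σt)) (λ via-t → σ∉S (inj₂ (t , σt , via-t))) via-w
              by-adjacency-to-a (inj₂ a-nonadj) = inj₂ λ where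
                ρ (inj₁ refl) q → a-nonadj t σt (E-sym (QE⇒E {x = σ} {ρ} q σt xa))
                ρ (inj₂ (w , ρw , via-w)) q →
                  via-nonadjacent t∉x xa xa′ (a-nonadj t σt ∘ E-sym) via-w (QE⇒E {x = σ} {ρ} q σt ρw)

      S-whole : ∀ κ → S κ
      S-whole = Prime.module-∋₂⇒whole prime {M = S} {x} {y}
                  S-module (inj₁ refl) (inj₂ (b , yb , via)) (x≢y ∘ cong proj₁)

  ¬via-sibling : ∀ {μ} (x y : QV μ) → proj₁ x ≢ proj₁ y
               → ∀ {a a′ b} → LQ x a → LQ x a′ → LQ y b → ¬ Via a b a′
  ¬via-sibling {μ} x y x≢y {a} {a′} {b} xa xa′ yb (ab , ba′) with classify μ (QV-inner x)
  ... | inj₁ edgeless         = edgeless x y (x≢y , a , b , xa , yb , O⇒E ab)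
  ... | inj₂ (inj₂ prime)    = ¬via-prime prime x y x≢y xa xa′ yb (ab , ba′)
  ... | inj₂ (inj₁ complete) =
    ¬join (proj₁ x) (λ x-inner → complete-child-¬complete x x-inner complete) join
    where
      b∉x : ¬ LQ x b
      b∉x = siblings-disjoint y x (x≢y ∘ sym) yb

      join : IsJoin (LQ x) (λ z → O z b) (O b)
      join = (λ z xz → O-total (E-sym (module-adj b∉x xa xz (E-sym (O⇒E ab)))))
           , (λ zb bz → O⇒E (O-trans zb bz))
           , (a , xa , ab) , (a′ , xa′ , ba′)

  source-uniform : ∀ {μ} (x y : QV μ) → proj₁ x ≢ proj₁ y
                 → ∀ {a a′ b} → LQ x a → LQ x a′ → LQ y b → O a b → O a′ b
  source-uniform x y x≢y xa xa′ yb ab with O-total (QE⇒E {x = x} {y} (x≢y , _ , _ , xa , yb , O⇒E ab) xa′ yb)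
  ... | inj₁ a′b = a′b
  ... | inj₂ ba′ = contradiction (ab , ba′) (¬via-sibling x y x≢y xa xa′ yb)

  target-uniform : ∀ {μ} (x y : QV μ) → proj₁ x ≢ proj₁ y
                 → ∀ {a a′ b} → LQ x a → LQ x a′ → LQ y b → O b a → O b a′
  target-uniform x y x≢y xa xa′ yb ba with O-total (QE⇒E {x = y} {x} (x≢y ∘ sym , _ , _ , yb , xa , O⇒E ba) yb xa′)
  ... | inj₁ ba′ = ba′
  ... | inj₂ a′b = contradiction ba (O-asym (source-uniform x y x≢y xa′ xa yb a′b))

  uniform : ∀ {μ} (x y : QV μ) → proj₁ x ≢ proj₁ y
          → ∀ {u u′ v v′} → LQ x u → LQ x u′ → LQ y v → LQ y v′ → O u v → O u′ v′
  uniform x y x≢y xu xu′ yv yv′ uv =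
    target-uniform y x (x≢y ∘ sym) yv yv′ xu′ (source-uniform x y x≢y xu xu′ yv uv)

  induced-transitiveOrientation : ∀ μ → IsTransitiveOrientation (QE G T μ) (InducedP G T O μ)
  induced-transitiveOrientation μ = ((P⇒QE , P-asym) , P-total) , P-trans
    where
      P = InducedP G T O μ

      P⇒QE : ∀ x y → P x y → QE G T μ x y
      P⇒QE x y (x≢y , u , v , xu , yv , uv) = x≢y , u , v , xu , yv , O⇒E uv

      P-asym : ∀ x y → P x y → ¬ P y x
      P-asym x y (x≢y , u , v , xu , yv , uv) (_ , v′ , u′ , yv′ , xu′ , v′u′) =
        O-asym (uniform x y x≢y xu xu′ yv yv′ uv) v′u′

      P-total : ∀ x y → QE G T μ x y → P x y ⊎ P y x
      P-total x y (x≢y , u , v , xu , yv , uv) =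
        map⊎ (λ u→v → x≢y , u , v , xu , yv , u→v) (λ v→u → x≢y ∘ sym , v , u , yv , xu , v→u) (O-total uv)

      P-trans : ∀ x y z → P x y → P y z → P x z
      P-trans x y z (x≢y , u , v , xu , yv , uv) (y≢z , v′ , w , yv′ , zw , v′w) =
        x≢z , u , w , xu , zw , O-trans uv′ v′w
        where
          uv′ : O u v′
          uv′ = uniform x y x≢y xu xu yv yv′ uv
          x≢z : proj₁ x ≢ proj₁ z
          x≢z x≡z = O-asym uv′ (uniform y x (x≢y ∘ sym) yv′ yv′ (subst (λ c → L c w) (sym x≡z) zw) xu v′w)

mainTheorem9 : ∀ {n : ℕ} (G : Graph n) (T : RootedTree n) (W : Fin n → Fin n → Set)
  → IsComparabilityGraph (Graph.E G)
  → IsCanonicalModularDecomposition G T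
  → IsPartialOrientation (Graph.E G) W
  → GivesPartialOrientation G T W
  → ExtendsToTransitiveOrientation G T W ⇔ QuotientExtends G T W
mainTheorem9 G T W _ canon (W⊆E , _) _ = mk⇔ restrict lift
  where
    restrict : ExtendsToTransitiveOrientation G T W → QuotientExtends G T W
    restrict (O , hO , W⊆O) =
      InducedP G T O , (λ μ _ → Induced.induced-transitiveOrientation G T canon hO μ)
                     , λ { μ x y (x≢y , u , v , xu , yv , uv) → x≢y , u , v , xu , yv , W⊆O u v uv }

    lift : QuotientExtends G T W → ExtendsToTransitiveOrientation G T W
    lift (O , hO , P⊆O) =
      Lift.lift G T (proj₁ canon) O , Lift.lift-transitiveOrientation G T (proj₁ canon) hO
                                    , Lift.lift-extends G T (proj₁ canon) W⊆E P⊆O
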